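{- Let $G_1,G_2$ be graphs with $E(G_1)\cap E(G_2)=\emptyset$ and $V(G_1)\cap V(G_2)=\{u,v\}$, let $G=G_1\cup G_2=(V(G_1)\cup V(G_2),E(G_1)\cup E(G_2))$, and assume $\tau(G)<1$. (1) If $S$ is a tough set of $G$ of minimum size with $S\cap\{u,v\}=\emptyset$, then $S\subseteq V(G_1)\setminus\{u,v\}$ or $S\subseteq V(G_2)\setminus\{u,v\}$. (2) If $S$ is a tough set of $G$ with $S\cap\{u,v\}=\emptyset$, and $S_1=S\cap V(G_1)$ and $S_2=S\cap V(G_2)$ are both nonempty, then $\frac{|S_1|}{c(G-S_1)}=\frac{|S_2|}{c(G-S_2)}=\tau(G)$.
   Context: For a graph $H$, $c(H)$ denotes its number of components. A set $S\subseteq V(G)$ is a cutset if $c(G-S)>1$. $G$ is $t$-tough if $|S|\ge t\cdot c(G-S)$ for every cutset $S$; the toughness $\tau(G)$ is the largest such $t$, with $\tau(K_n)=\infty$. A tough set of $G$ is a cutset $S$ with $|S|=\tau(G)\cdot c(G-S)$. -}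

module Defs where

open import Data.Bool using (Bool; true; false; _∨_)
open import Data.Nat as ℕ using (ℕ)
open import Data.Integer using (+_)
open import Data.Rational using (ℚ; _/_; _*_; _≤_)
open import Data.Fin using (Fin)
open import Data.Fin.Subset using (Subset; _∈_; _∉_; ∣_∣)
open import Data.Product using (Σ; ∃; _×_)
open import Relation.Binary.PropositionalEquality using (_≡_)
open import Relation.Nullary using (¬_)
open import Function.Bundles using (_⇔_)

record Graph (n : ℕ) : Set where
  field
    adj   : Fin n → Fin n → Bool
    sym   : ∀ x y → adj x y ≡ adj y x
    irrefl : ∀ x → adj x x ≡ false
open Graph public

[_]ℚ : ℕ → ℚ
[ m ]ℚ = + m / 1

data Conn {n : ℕ} (G : Graph n) (S : Subset n) : Fin n → Fin n → Set where
  here : ∀ {x} → x ∉ S → Conn G S x x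
  step : ∀ {x y z} → x ∉ S → adj G x y ≡ true → Conn G S y z → Conn G S x z

-- NumComp G S k : c(G - S) = k.  A labelling of the vertices of G - S by
-- Fin k, surjective, with equal labels exactly for vertices in the same
-- component.
NumComp : ∀ {n} → Graph n → Subset n → ℕ → Set
NumComp {n} G S k =
  Σ ((x : Fin n) → x ∉ S → Fin k) λ f →
    (∀ (i : Fin k) → ∃ λ x → Σ (x ∉ S) λ p → f x p ≡ i) ×
    (∀ x y (p : x ∉ S) (q : y ∉ S) → (f x p ≡ f y q) ⇔ Conn G S x y)

IsCutset : ∀ {n} → Graph n → Subset n → Set
IsCutset G S = ∃ λ k → NumComp G S k × (1 ℕ.< k)

IsTough : ∀ {n} → Graph n → ℚ → Set
IsTough G t = ∀ S k → NumComp G S k → 1 ℕ.< k → t * [ k ]ℚ ≤ [ ∣ S ∣ ]ℚ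

-- τ(G) = t : t is the largest t such that G is t-tough.
-- (For complete graphs no rational t satisfies this, matching τ(K_n) = ∞.)
IsToughness : ∀ {n} → Graph n → ℚ → Set
IsToughness G t = IsTough G t × (∀ t' → IsTough G t' → t' ≤ t)

IsToughSet : ∀ {n} → Graph n → ℚ → Subset n → Set
IsToughSet G t S = ∃ λ k → NumComp G S k × (1 ℕ.< k) × ([ ∣ S ∣ ]ℚ ≡ t * [ k ]ℚ)

_∪G_ : ∀ {n} → Graph n → Graph n → Graph n
G₁ ∪G G₂ = record
  { adj = λ x y → adj G₁ x y ∨ adj G₂ x y
  ; sym = λ x y → cong₂' (sym G₁ x y) (sym G₂ x y)
  ; irrefl = λ x → cong₂' (irrefl G₁ x) (irrefl G₂ x) }
  where
  open import Relation.Binary.PropositionalEquality using (cong₂)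
  cong₂' : ∀ {a b c d : Bool} → a ≡ c → b ≡ d → (a ∨ b) ≡ (c ∨ d)
  cong₂' = cong₂ _∨_

-- G is a graph with vertex set V (edges only between vertices of V)
EdgesWithin : ∀ {n} → Graph n → Subset n → Set
EdgesWithin {n} G V = ∀ (x y : Fin n) → adj G x y ≡ true → x ∈ V × y ∈ V

-- Let S be a tough set avoiding u and v, and Sᵢ = S ∩ V(Gᵢ). A component of G - S either
-- contains u or v, or avoids both and then lies in one Gᵢ - {u, v}, where it is also a component
-- of G - Sᵢ. Charging the component of u to G - S₁ and that of v to G - S₂ gives
-- c(G - S) ≤ c(G - S₁) + c(G - S₂). Toughness gives |Sᵢ| ≥ τ c(G - Sᵢ) (when c(G - Sᵢ) ≤ 1,
-- because τ < 1 ≤ |Sᵢ|), while |S₁| + |S₂| = |S| = τ c(G - S); so both inequalities are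
-- equalities, which is (2). Under the hypotheses of (1) with both Sᵢ nonempty, S₁ would then be
-- a tough set (c(G - S₁) = 1 would force |S₁| = τ < 1) smaller than S.

{-# OPTIONS --safe #-}
module Submission where

open import Defs
open import Level using (0ℓ)
open import Data.Bool using (true; false)
open import Data.Bool.Properties using () renaming (_≟_ to _≟ᵇ_)
open import Data.Nat as ℕ using (ℕ; zero; suc; z≤n; s≤s)
import Data.Nat.Properties as ℕ
open import Data.Integer as ℤ using (+_)
import Data.Integer.Properties as ℤ
open import Data.Rational using (ℚ; mkℚ; _<_; _≤_; 1ℚ; 0ℚ; _*_; _+_; *≤*; nonNegative)
import Data.Rational.Properties as ℚ
import Data.Nat.Coprimality as Coprime
open import Data.Fin using (Fin; zero; suc; join; splitAt)
open import Data.Fin.Properties using (any?; injective⇒≤; suc-injective; splitAt-join; ¬Fin0)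
  renaming (_≟_ to _≟ᶠ_)
open import Data.Fin.Subset
  using (Subset; _∈_; _∉_; ∣_∣; _∩_; _∪_; ⁅_⁆; _⊆_; Nonempty; Empty; inside; outside)
open import Data.Fin.Subset.Properties
  using (_∈?_; nonempty?; x∈p∪q⁻; x∈p∪q⁺; x∈p∩q⁻; x∈p∩q⁺; p⊆p∪q; q⊆p∪q; x∈⁅x⁆; x∈⁅y⁆⇒x≡y;
         p⊂q⇒∣p∣<∣q∣; ∣p∣≤n; ∣p∣≡n⇒p≡⊤; ∈⊤; drop-∷-⊆; drop-∷-Empty; x∈p⇒∣p-x∣<∣p∣)
open import Data.Vec using ([]; _∷_; here)
open import Data.Product using (_×_; _,_; ∃; Σ; proj₁; proj₂)
open import Data.Sum using (_⊎_; inj₁; inj₂; [_,_]; swap)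
open import Data.Sum.Properties using (inj₁-injective; inj₂-injective)
open import Data.Empty using (⊥; ⊥-elim)
open import Relation.Binary.PropositionalEquality as ≡ using (_≡_; _≢_; refl; trans; subst; cong)
open import Relation.Nullary using (¬_; Dec; yes; no; ¬?; _×-dec_)
import Relation.Nullary.Decidable as Dec
open import Relation.Unary using (Pred)
import Relation.Unary as U
open import Relation.Binary using (Rel; Symmetric; Transitive)
import Relation.Binary as B
open import Function.Base using (_∘_; _on_; id)
open import Function.Bundles using (_⇔_; mk⇔; Equivalence)

private variable
  n m k : ℕ
  S T V : Subset n
  a w x y z : Fin n

∉-∪⁅⁆ : y ∉ S → y ≢ x → y ∉ S ∪ ⁅ x ⁆
∉-∪⁅⁆ {S = S} {x = x} y∉S y≢x y∈ =
  [ y∉S , (λ y∈⁅x⁆ → y≢x (x∈⁅y⁆⇒x≡y x y∈⁅x⁆)) ] (x∈p∪q⁻ S ⁅ x ⁆ y∈)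

module _ (G : Graph n) where

  conn-source : Conn G S x y → x ∉ S
  conn-source (here x∉S)     = x∉S
  conn-source (step x∉S _ _) = x∉S

  conn-target : Conn G S x y → y ∉ S
  conn-target (here y∉S)   = y∉S
  conn-target (step _ _ c) = conn-target c

  conn-trans : Conn G S x y → Conn G S y z → Conn G S x z
  conn-trans (here _)     d = d
  conn-trans (step p e c) d = step p e (conn-trans c d)

  conn-sym : Conn G S x y → Conn G S y x
  conn-sym (here p) = here p
  conn-sym {x = x} (step {y = y} p e c) =
    conn-trans (conn-sym c) (step (conn-source c) (trans (Graph.sym G y x) e) (here p))

  conn-via : Conn G S x w → Conn G S w z → Conn G S y z → Conn G S x y
  conn-via x→w w→z y→z = conn-trans x→w (conn-trans w→z (conn-sym y→z))

  conn-antimono : S ⊆ T → Conn G T x y → Conn G S x y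
  conn-antimono S⊆T (here p)     = here (λ x∈S → p (S⊆T x∈S))
  conn-antimono S⊆T (step p e c) = step (λ x∈S → p (S⊆T x∈S)) e (conn-antimono S⊆T c)

  conn-last-visit : ∀ x → Conn G S w y →
    Conn G (S ∪ ⁅ x ⁆) w y ⊎ x ≡ y ⊎ ∃ λ x′ → adj G x x′ ≡ true × Conn G (S ∪ ⁅ x ⁆) x′ y
  conn-last-visit {w = w} x (here w∉S) with w ≟ᶠ x
  ... | yes refl = inj₂ (inj₁ refl)
  ... | no w≢x   = inj₁ (here (∉-∪⁅⁆ w∉S w≢x))
  conn-last-visit {w = w} x (step {y = w′} w∉S e d) with conn-last-visit x d | w ≟ᶠ x
  ... | inj₂ later | _        = inj₂ later
  ... | inj₁ d′    | yes refl = inj₂ (inj₂ (w′ , e , d′))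
  ... | inj₁ d′    | no w≢x   = inj₁ (step (∉-∪⁅⁆ w∉S w≢x) e d′)

  conn⇔step-avoiding : x ∉ S → x ≢ y →
    Conn G S x y ⇔ ∃ λ x′ → adj G x x′ ≡ true × Conn G (S ∪ ⁅ x ⁆) x′ y
  conn⇔step-avoiding {x = x} {S = S} x∉S x≢y = mk⇔ to from
    where
    to : Conn G S x _ → ∃ λ x′ → adj G x x′ ≡ true × Conn G (S ∪ ⁅ x ⁆) x′ _
    to c with conn-last-visit x c
    ... | inj₁ d              = ⊥-elim (conn-source d (q⊆p∪q S ⁅ x ⁆ (x∈⁅x⁆ x)))
    ... | inj₂ (inj₁ x≡y)     = ⊥-elim (x≢y x≡y)
    ... | inj₂ (inj₂ through) = through
    from : (∃ λ x′ → adj G x x′ ≡ true × Conn G (S ∪ ⁅ x ⁆) x′ _) → Conn G S x _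
    from (_ , e , d) = step x∉S e (conn-antimono (p⊆p∪q ⁅ x ⁆) d)

  -- The fuel m bounds the number of vertices outside S; each step removes one more.
  conn-dec′ : ∀ m (S : Subset n) → n ℕ.≤ m ℕ.+ ∣ S ∣ → ∀ x y → Dec (Conn G S x y)
  conn-dec′ zero S n≤∣S∣ x y = no (λ c → conn-source c S-full)
    where
    S-full : x ∈ S
    S-full = subst (x ∈_) (≡.sym (∣p∣≡n⇒p≡⊤ (ℕ.≤-antisym (∣p∣≤n S) n≤∣S∣))) ∈⊤
  conn-dec′ (suc m) S n≤m+∣S∣ x y with x ∈? S | x ≟ᶠ y
  ... | yes x∈S | _        = no (λ c → conn-source c x∈S)
  ... | no x∉S  | yes refl = yes (here x∉S)
  ... | no x∉S  | no x≢y   =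
    Dec.map′ from to
      (any? (λ x′ → (adj G x x′ ≟ᵇ true) ×-dec conn-dec′ m (S ∪ ⁅ x ⁆) n≤m+∣S∪x∣ x′ y))
    where
    open Equivalence (conn⇔step-avoiding x∉S x≢y)
    ∣S∣<∣S∪x∣ : ∣ S ∣ ℕ.< ∣ S ∪ ⁅ x ⁆ ∣
    ∣S∣<∣S∪x∣ = p⊂q⇒∣p∣<∣q∣ (p⊆p∪q ⁅ x ⁆ , x , q⊆p∪q S ⁅ x ⁆ (x∈⁅x⁆ x) , x∉S)
    n≤m+∣S∪x∣ : n ℕ.≤ m ℕ.+ ∣ S ∪ ⁅ x ⁆ ∣
    n≤m+∣S∪x∣ = ℕ.≤-trans n≤m+∣S∣
      (ℕ.≤-trans (ℕ.≤-reflexive (≡.sym (ℕ.+-suc m ∣ S ∣))) (ℕ.+-monoʳ-≤ m ∣S∣<∣S∪x∣))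

  conn? : ∀ (S : Subset n) x y → Dec (Conn G S x y)
  conn? S = conn-dec′ n S (ℕ.m≤m+n n ∣ S ∣)

-- NumComp G S k is Labelling (_∉ S) (Conn G S) k.
Labelling : (P : Pred (Fin n) 0ℓ) → Rel (Fin n) 0ℓ → ℕ → Set
Labelling {n} P R k = Σ ((x : Fin n) → P x → Fin k) λ f →
  (∀ (i : Fin k) → ∃ λ x → Σ (P x) λ p → f x p ≡ i) ×
  (∀ x y (p : P x) (q : P y) → (f x p ≡ f y q) ⇔ R x y)

module _ {P : Pred (Fin (suc n)) 0ℓ} {R : Rel (Fin (suc n)) 0ℓ}
         (R-refl : ∀ {x} → P x → R x x) (R-sym : Symmetric R) (R-trans : Transitive R) {k : ℕ} where

  labelling-skip-zero : Labelling (P ∘ suc) (R on suc) k → ¬ P zero → Labelling P R k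
  labelling-skip-zero (f , f-surj , f-classes) ¬P0 = g , g-surj , g-classes
    where
    g : (x : Fin (suc n)) → P x → Fin k
    g zero    p = ⊥-elim (¬P0 p)
    g (suc x) p = f x p
    g-surj : ∀ (i : Fin k) → ∃ λ x → Σ (P x) λ p → g x p ≡ i
    g-surj i = let x , p , fx≡i = f-surj i in suc x , p , fx≡i
    g-classes : ∀ x y (p : P x) (q : P y) → (g x p ≡ g y q) ⇔ R x y
    g-classes zero    _       p _ = ⊥-elim (¬P0 p)
    g-classes (suc _) zero    _ q = ⊥-elim (¬P0 q)
    g-classes (suc x) (suc y) p q = f-classes x y p q

  labelling-join-zero : Labelling (P ∘ suc) (R on suc) k →
    ∀ z → P (suc z) → R zero (suc z) → Labelling P R k
  labelling-join-zero (f , f-surj , f-classes) z pz R0z = g , g-surj , g-classes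
    where
    g : (x : Fin (suc n)) → P x → Fin k
    g zero    _ = f z pz
    g (suc x) p = f x p
    g-surj : ∀ (i : Fin k) → ∃ λ x → Σ (P x) λ p → g x p ≡ i
    g-surj i = let x , p , fx≡i = f-surj i in suc x , p , fx≡i
    g-classes : ∀ x y (p : P x) (q : P y) → (g x p ≡ g y q) ⇔ R x y
    g-classes zero    zero    p _ = mk⇔ (λ _ → R-refl p) (λ _ → refl)
    g-classes zero    (suc y) _ q = mk⇔ (R-trans R0z ∘ to) (from ∘ R-trans (R-sym R0z))
      where open Equivalence (f-classes z y pz q)
    g-classes (suc x) zero    p _ =
      mk⇔ (λ e → R-trans (to e) (R-sym R0z)) (λ r → from (R-trans r R0z))
      where open Equivalence (f-classes x z p pz)
    g-classes (suc x) (suc y) p q = f-classes x y p q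

  labelling-new-zero : Labelling (P ∘ suc) (R on suc) k →
    P zero → (∀ z → P (suc z) → ¬ R zero (suc z)) → Labelling P R (suc k)
  labelling-new-zero (f , f-surj , f-classes) P0 new = g , g-surj , g-classes
    where
    g : (x : Fin (suc n)) → P x → Fin (suc k)
    g zero    _ = zero
    g (suc x) p = suc (f x p)
    g-surj : ∀ (i : Fin (suc k)) → ∃ λ x → Σ (P x) λ p → g x p ≡ i
    g-surj zero    = zero , P0 , refl
    g-surj (suc i) = let x , p , fx≡i = f-surj i in suc x , p , cong suc fx≡i
    g-classes : ∀ x y (p : P x) (q : P y) → (g x p ≡ g y q) ⇔ R x y
    g-classes zero    zero    p _ = mk⇔ (λ _ → R-refl p) (λ _ → refl)
    g-classes zero    (suc y) _ q = mk⇔ (λ ()) (λ r → ⊥-elim (new y q r))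
    g-classes (suc x) zero    p _ = mk⇔ (λ ()) (λ r → ⊥-elim (new x p (R-sym r)))
    g-classes (suc x) (suc y) p q =
      mk⇔ (to ∘ suc-injective) (cong suc ∘ from)
      where open Equivalence (f-classes x y p q)

labelling : {P : Pred (Fin n) 0ℓ} {R : Rel (Fin n) 0ℓ} → U.Decidable P → B.Decidable R →
  (∀ {x} → P x → R x x) → Symmetric R → Transitive R → ∃ (Labelling P R)
labelling {zero} _ _ _ _ _ = 0 , (λ ()) , (λ ()) , (λ ())
labelling {suc n} {P} {R} P? R? R-refl R-sym R-trans
  with labelling (P? ∘ suc) (λ x y → R? (suc x) (suc y)) R-refl R-sym R-trans
     | P? zero | any? (λ z → P? (suc z) ×-dec R? zero (suc z))
... | k , L | no ¬P0 | _                   = k , labelling-skip-zero R-refl R-sym R-trans L ¬P0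
... | k , L | yes _  | yes (z , pz , R0z)  = k , labelling-join-zero R-refl R-sym R-trans L z pz R0z
... | k , L | yes P0 | no ¬∃               =
  suc k , labelling-new-zero R-refl R-sym R-trans L P0 (λ z pz R0z → ¬∃ (z , pz , R0z))

-- g composed with a choice of class representatives is injective.
labelling-≤ : {P : Pred (Fin n) 0ℓ} {R : Rel (Fin n) 0ℓ} → Labelling P R k →
  (g : (x : Fin n) → P x → Fin m) → (∀ x y p q → g x p ≡ g y q → R x y) → k ℕ.≤ m
labelling-≤ {k = k} {P = P} (f , f-surj , f-classes) g g-reflects = injective⇒≤ g∘rep-injective
  where
  rep : Fin k → Fin _
  rep i = proj₁ (f-surj i)
  rep-P : ∀ i → P (rep i)
  rep-P i = proj₁ (proj₂ (f-surj i))
  f-rep : ∀ i → f (rep i) (rep-P i) ≡ i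
  f-rep i = proj₂ (proj₂ (f-surj i))
  g∘rep-injective : ∀ {i j} → g (rep i) (rep-P i) ≡ g (rep j) (rep-P j) → i ≡ j
  g∘rep-injective {i} {j} e = begin
    i                        ≡⟨ ≡.sym (f-rep i) ⟩
    f (rep i) (rep-P i)      ≡⟨ Equivalence.from (f-classes _ _ _ _) (g-reflects _ _ _ _ e) ⟩
    f (rep j) (rep-P j)      ≡⟨ f-rep j ⟩
    j                        ∎
    where open ≡.≡-Reasoning

numComp : (G : Graph n) (S : Subset n) → ∃ (NumComp G S)
numComp G S = labelling (λ x → ¬? (x ∈? S)) (conn? G S) here (conn-sym G) (conn-trans G)

numComp-nonZero : ∀ {G : Graph n} → x ∉ S → NumComp G S k → k ≢ 0
numComp-nonZero x∉S (f , _) refl = ¬Fin0 (f _ x∉S)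

∣p∣≡∣p∩q∣+∣p∩r∣ : ∀ (p q r : Subset n) → p ⊆ q ∪ r → Empty (p ∩ q ∩ r) →
  ∣ p ∣ ≡ ∣ p ∩ q ∣ ℕ.+ ∣ p ∩ r ∣
∣p∣≡∣p∩q∣+∣p∩r∣ [] [] [] _ _ = refl
∣p∣≡∣p∩q∣+∣p∩r∣ (outside ∷ p) (_ ∷ q) (_ ∷ r) p⊆q∪r disj =
  ∣p∣≡∣p∩q∣+∣p∩r∣ p q r (drop-∷-⊆ p⊆q∪r) (drop-∷-Empty disj)
∣p∣≡∣p∩q∣+∣p∩r∣ (inside ∷ p) (inside ∷ q) (inside ∷ r) _ disj = ⊥-elim (disj (zero , here))
∣p∣≡∣p∩q∣+∣p∩r∣ (inside ∷ p) (inside ∷ q) (outside ∷ r) p⊆q∪r disj =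
  cong suc (∣p∣≡∣p∩q∣+∣p∩r∣ p q r (drop-∷-⊆ p⊆q∪r) (drop-∷-Empty disj))
∣p∣≡∣p∩q∣+∣p∩r∣ (inside ∷ p) (outside ∷ q) (inside ∷ r) p⊆q∪r disj =
  trans (cong suc (∣p∣≡∣p∩q∣+∣p∩r∣ p q r (drop-∷-⊆ p⊆q∪r) (drop-∷-Empty disj)))
        (≡.sym (ℕ.+-suc ∣ p ∩ q ∣ ∣ p ∩ r ∣))
∣p∣≡∣p∩q∣+∣p∩r∣ (inside ∷ p) (outside ∷ q) (outside ∷ r) p⊆q∪r _ with p⊆q∪r here
... | ()

nonempty⇒∣p∣≥1 : ∀ {p : Subset n} → Nonempty p → 1 ℕ.≤ ∣ p ∣
nonempty⇒∣p∣≥1 (_ , x∈p) = ℕ.≤-<-trans z≤n (x∈p⇒∣p-x∣<∣p∣ x∈p)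

∉-∩ : x ∉ S → x ∉ S ∩ V
∉-∩ {S = S} {V = V} x∉S x∈S∩V = x∉S (proj₁ (x∈p∩q⁻ S V x∈S∩V))

∈-other-side : Empty (S ∩ V) → x ∈ S → x ∈ T ⊎ x ∈ V → x ∈ T
∈-other-side S∩V≡∅ x∈S = [ id , (λ x∈V → ⊥-elim (S∩V≡∅ (_ , x∈p∩q⁺ (x∈S , x∈V)))) ]

join-injective : ∀ {i j : Fin m ⊎ Fin k} → join m k i ≡ join m k j → i ≡ j
join-injective {m} {k} {i} {j} e = begin
  i                           ≡⟨ ≡.sym (splitAt-join m k i) ⟩
  splitAt m (join m k i)      ≡⟨ cong (splitAt m) e ⟩
  splitAt m (join m k j)      ≡⟨ splitAt-join m k j ⟩
  j                           ∎
  where open ≡.≡-Reasoning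

[m]ℚ≡mkℚ : ∀ m → [ m ]ℚ ≡ mkℚ (+ m) 0 (Coprime.sym (Coprime.1-coprimeTo m))
[m]ℚ≡mkℚ m = ℚ.normalize-coprime (Coprime.sym (Coprime.1-coprimeTo m))

[m+n]ℚ : ∀ m k → [ m ℕ.+ k ]ℚ ≡ [ m ]ℚ + [ k ]ℚ
[m+n]ℚ m k rewrite [m]ℚ≡mkℚ m | [m]ℚ≡mkℚ k = ℚ./-cong {+ (m ℕ.+ k)} {1} m+k≡m*1+k*1 refl
  where
  m+k≡m*1+k*1 : + (m ℕ.+ k) ≡ (+ m ℤ.* + 1) ℤ.+ (+ k ℤ.* + 1)
  m+k≡m*1+k*1 rewrite ℤ.*-identityʳ (+ m) | ℤ.*-identityʳ (+ k) = ℤ.pos-+ m k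

[]ℚ-mono-≤ : m ℕ.≤ k → [ m ]ℚ ≤ [ k ]ℚ
[]ℚ-mono-≤ {m} {k} m≤k rewrite [m]ℚ≡mkℚ m | [m]ℚ≡mkℚ k =
  *≤* (≡.subst₂ ℤ._≤_ (≡.sym (ℤ.*-identityʳ (+ m))) (≡.sym (ℤ.*-identityʳ (+ k))) (ℤ.+≤+ m≤k))

squeeze : ∀ {a b c d : ℚ} → a ≤ b → c ≤ d → b + d ≤ a + c → b ≡ a × d ≡ c
squeeze {a} {b} {c} {d} a≤b c≤d b+d≤a+c = ≤-tight a≤b c≤d b+d≤a+c , ≤-tight c≤d a≤b d+b≤c+a
  where
  ≤-tight : ∀ {a b c d : ℚ} → a ≤ b → c ≤ d → b + d ≤ a + c → b ≡ a
  ≤-tight a≤b c≤d b+d≤a+c = ℚ.≤-antisym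
    (ℚ.≮⇒≥ λ a<b → ℚ.<-irrefl refl (ℚ.<-≤-trans (ℚ.+-mono-<-≤ a<b c≤d) b+d≤a+c)) a≤b
  d+b≤c+a : d + b ≤ c + a
  d+b≤c+a rewrite ℚ.+-comm d b | ℚ.+-comm c a = b+d≤a+c

module _ {G : Graph n} {t : ℚ} where

  toughness-nonNeg : IsToughness G t → 0ℚ ≤ t
  toughness-nonNeg (_ , t-max) =
    t-max 0ℚ λ S k _ _ →
      subst (_≤ [ ∣ S ∣ ]ℚ) (≡.sym (ℚ.*-zeroˡ [ k ]ℚ)) ([]ℚ-mono-≤ {k = ∣ S ∣} z≤n)

  -- Toughness only constrains cutsets; for c(G - S) ≤ 1 the bound comes from t ≤ 1 ≤ |S|.
  tough⇒t*c≤∣S∣ : IsTough G t → t ≤ 1ℚ → Nonempty S → NumComp G S k → t * [ k ]ℚ ≤ [ ∣ S ∣ ]ℚ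
  tough⇒t*c≤∣S∣ {S = S} {k = zero} _ _ _ _ =
    subst (_≤ _) (≡.sym (ℚ.*-zeroʳ t)) ([]ℚ-mono-≤ {k = ∣ S ∣} z≤n)
  tough⇒t*c≤∣S∣ {S = S} {k = suc zero} _ t≤1 S≢∅ _ =
    subst (_≤ _) (≡.sym (ℚ.*-identityʳ t))
      (ℚ.≤-trans t≤1 ([]ℚ-mono-≤ {k = ∣ S ∣} (nonempty⇒∣p∣≥1 S≢∅)))
  tough⇒t*c≤∣S∣ {S = S} {k = suc (suc k)} tough _ _ N = tough S (suc (suc k)) N (s≤s (s≤s z≤n))

  toughSet-of-≡ : t < 1ℚ → Nonempty S → NumComp G S k → k ≢ 0 →
    [ ∣ S ∣ ]ℚ ≡ t * [ k ]ℚ → IsToughSet G t S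
  toughSet-of-≡ {k = zero} _ _ _ k≢0 _ = ⊥-elim (k≢0 refl)
  toughSet-of-≡ {S = S} {k = suc zero} t<1 S≢∅ _ _ ∣S∣≡t = ⊥-elim (ℚ.<-irrefl refl (begin-strict
    [ 1 ]ℚ        ≤⟨ []ℚ-mono-≤ (nonempty⇒∣p∣≥1 S≢∅) ⟩
    [ ∣ S ∣ ]ℚ    ≡⟨ trans ∣S∣≡t (ℚ.*-identityʳ t) ⟩
    t             <⟨ t<1 ⟩
    1ℚ            ∎))
    where open ℚ.≤-Reasoning
  toughSet-of-≡ {k = suc (suc k)} _ _ N _ ∣S∣≡t*c = suc (suc k) , N , s≤s (s≤s z≤n) , ∣S∣≡t*c

module TwoSeparation (G₁ G₂ : Graph n) (V₁ V₂ : Subset n) (u v : Fin n)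
  (E₁ : EdgesWithin G₁ V₁) (E₂ : EdgesWithin G₂ V₂)
  (V₁∩V₂ : ∀ x → (x ∈ V₁ × x ∈ V₂) ⇔ (x ≡ u ⊎ x ≡ v))
  (V₁∪V₂ : ∀ x → x ∈ V₁ ⊎ x ∈ V₂) where

  G : Graph n
  G = G₁ ∪G G₂

  shared⇒u-or-v : x ∈ V₁ → x ∈ V₂ → x ≢ u → x ≢ v → ⊥
  shared⇒u-or-v x∈V₁ x∈V₂ x≢u x≢v =
    [ x≢u , x≢v ] (Equivalence.to (V₁∩V₂ _) (x∈V₁ , x∈V₂))

  ClosedAwayFromUV : Subset n → Set
  ClosedAwayFromUV V = ∀ {x y} → adj G x y ≡ true → x ∈ V → x ≢ u → x ≢ v → y ∈ V

  V₁-closed : ClosedAwayFromUV V₁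
  V₁-closed {x} {y} xy∈G x∈V₁ x≢u x≢v with adj G₁ x y in xy∈G₁
  ... | true  = proj₂ (E₁ x y xy∈G₁)
  ... | false = ⊥-elim (shared⇒u-or-v x∈V₁ (proj₁ (E₂ x y xy∈G)) x≢u x≢v)

  V₂-closed : ClosedAwayFromUV V₂
  V₂-closed {x} {y} xy∈G x∈V₂ x≢u x≢v with adj G₁ x y in xy∈G₁
  ... | true  = ⊥-elim (shared⇒u-or-v (proj₁ (E₁ x y xy∈G₁)) x∈V₂ x≢u x≢v)
  ... | false = proj₂ (E₂ x y xy∈G)

  module _ (S : Subset n) (u∉S : u ∉ S) (v∉S : v ∉ S) where

    Isolated : Fin n → Set
    Isolated x = ¬ Conn G S x u × ¬ Conn G S x v

    isolated-step : x ∉ S → adj G x y ≡ true → Isolated x → Isolated y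
    isolated-step x∉S xy∈G (x↛u , x↛v) = x↛u ∘ step x∉S xy∈G , x↛v ∘ step x∉S xy∈G

    -- An isolated vertex of V never reaches u or v, so its walks stay in V,
    -- where S and S ∩ V agree.
    conn-∩-isolated : ClosedAwayFromUV V → x ∈ V → Isolated x → Conn G (S ∩ V) x y → Conn G S x y
    conn-∩-isolated {V = V} _ x∈V _ (here x∉S∩V) = here (λ x∈S → x∉S∩V (x∈p∩q⁺ (x∈S , x∈V)))
    conn-∩-isolated {V = V} {x = x} closed x∈V iso@(x↛u , x↛v) (step x∉S∩V xy∈G c) =
      step x∉S xy∈G
        (conn-∩-isolated closed (closed xy∈G x∈V x≢u x≢v) (isolated-step x∉S xy∈G iso) c)
      where
      x∉S : x ∉ S
      x∉S x∈S = x∉S∩V (x∈p∩q⁺ (x∈S , x∈V))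
      x≢u : x ≢ u
      x≢u refl = x↛u (here x∉S)
      x≢v : x ≢ v
      x≢v refl = x↛v (here x∉S)

    -- Representatives of components of G - S on the side V to which the cut vertex a is charged.
    Anchor : Fin n → Subset n → Fin n → Set
    Anchor a V w = w ≡ a ⊎ (w ∈ V × Isolated w)

    conn-anchors : ClosedAwayFromUV V → a ∉ S → Anchor a V w → Anchor a V z →
      Conn G (S ∩ V) w z → Conn G S w z
    conn-anchors closed _ (inj₂ (w∈V , iso)) _ c = conn-∩-isolated closed w∈V iso c
    conn-anchors closed _ (inj₁ refl) (inj₂ (z∈V , iso)) c =
      conn-sym G (conn-∩-isolated closed z∈V iso (conn-sym G c))
    conn-anchors _ a∉S (inj₁ refl) (inj₁ refl) _ = here a∉S

    Anchored : Fin n → Set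
    Anchored x = ∃ λ w → Conn G S x w × (Anchor u V₁ w ⊎ Anchor v V₂ w)

    anchored : x ∉ S → Anchored x
    anchored {x} x∉S with conn? G S x u | conn? G S x v | x ∈? V₁
    ... | yes x→u | _        | _        = u , x→u , inj₁ (inj₁ refl)
    ... | no _    | yes x→v  | _        = v , x→v , inj₂ (inj₁ refl)
    ... | no x↛u  | no x↛v   | yes x∈V₁ = x , here x∉S , inj₁ (inj₂ (x∈V₁ , x↛u , x↛v))
    ... | no x↛u  | no x↛v   | no x∉V₁  =
      x , here x∉S , inj₂ (inj₂ ([ ⊥-elim ∘ x∉V₁ , id ] (V₁∪V₂ x) , x↛u , x↛v))

    anchor-label : ∀ {k₁ k₂} → NumComp G (S ∩ V₁) k₁ → NumComp G (S ∩ V₂) k₂ →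
      Anchored x → Fin k₁ ⊎ Fin k₂
    anchor-label (f₁ , _) _ (w , x→w , inj₁ _) = inj₁ (f₁ w (∉-∩ (conn-target G x→w)))
    anchor-label _ (f₂ , _) (w , x→w , inj₂ _) = inj₂ (f₂ w (∉-∩ (conn-target G x→w)))

    anchor-label-reflects : ∀ {k₁ k₂} (N₁ : NumComp G (S ∩ V₁) k₁) (N₂ : NumComp G (S ∩ V₂) k₂) →
      (α : Anchored x) (β : Anchored y) →
      anchor-label N₁ N₂ α ≡ anchor-label N₁ N₂ β → Conn G S x y
    anchor-label-reflects (_ , _ , f₁-classes) _ (w , x→w , inj₁ w⚓) (z , y→z , inj₁ z⚓) e =
      conn-via G x→w (conn-anchors V₁-closed u∉S w⚓ z⚓
                       (Equivalence.to (f₁-classes w z _ _) (inj₁-injective e))) y→z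
    anchor-label-reflects _ (_ , _ , f₂-classes) (w , x→w , inj₂ w⚓) (z , y→z , inj₂ z⚓) e =
      conn-via G x→w (conn-anchors V₂-closed v∉S w⚓ z⚓
                       (Equivalence.to (f₂-classes w z _ _) (inj₂-injective e))) y→z
    anchor-label-reflects _ _ (_ , _ , inj₁ _) (_ , _ , inj₂ _) ()
    anchor-label-reflects _ _ (_ , _ , inj₂ _) (_ , _ , inj₁ _) ()

    components-≤ : NumComp G S k → ∀ {k₁ k₂} →
      NumComp G (S ∩ V₁) k₁ → NumComp G (S ∩ V₂) k₂ → k ℕ.≤ k₁ ℕ.+ k₂
    components-≤ N {k₁} {k₂} N₁ N₂ =
      labelling-≤ N (λ _ x∉S → join k₁ k₂ (anchor-label N₁ N₂ (anchored x∉S)))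
        (λ _ _ x∉S y∉S e →
          anchor-label-reflects N₁ N₂ (anchored x∉S) (anchored y∉S) (join-injective e))

    ∈S⇒≢u : x ∈ S → x ≢ u
    ∈S⇒≢u x∈S refl = u∉S x∈S

    ∈S⇒≢v : x ∈ S → x ≢ v
    ∈S⇒≢v x∈S refl = v∉S x∈S

    ∣S∣≡∣S∩V₁∣+∣S∩V₂∣ : ∣ S ∣ ≡ ∣ S ∩ V₁ ∣ ℕ.+ ∣ S ∩ V₂ ∣
    ∣S∣≡∣S∩V₁∣+∣S∩V₂∣ = ∣p∣≡∣p∩q∣+∣p∩r∣ S V₁ V₂ (λ _ → x∈p∪q⁺ (V₁∪V₂ _)) S∩V₁∩V₂≡∅
      where
      S∩V₁∩V₂≡∅ : Empty (S ∩ V₁ ∩ V₂)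
      S∩V₁∩V₂≡∅ (x , x∈S∩V₁∩V₂) =
        let x∈S , x∈V₁∩V₂ = x∈p∩q⁻ S _ x∈S∩V₁∩V₂
            x∈V₁ , x∈V₂   = x∈p∩q⁻ V₁ V₂ x∈V₁∩V₂
        in shared⇒u-or-v x∈V₁ x∈V₂ (∈S⇒≢u x∈S) (∈S⇒≢v x∈S)

    module _ {t : ℚ} (τ : IsToughness G t) (t<1 : t < 1ℚ) where

      toughSet-pieces-tight : IsToughSet G t S → Nonempty (S ∩ V₁) → Nonempty (S ∩ V₂) →
        ∀ {k₁ k₂} → NumComp G (S ∩ V₁) k₁ → NumComp G (S ∩ V₂) k₂ →
        [ ∣ S ∩ V₁ ∣ ]ℚ ≡ t * [ k₁ ]ℚ × [ ∣ S ∩ V₂ ∣ ]ℚ ≡ t * [ k₂ ]ℚ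
      toughSet-pieces-tight (k , N , _ , ∣S∣≡t*k) S₁≢∅ S₂≢∅ {k₁} {k₂} N₁ N₂ =
        squeeze (tough⇒t*c≤∣S∣ (proj₁ τ) (ℚ.<⇒≤ t<1) S₁≢∅ N₁)
                (tough⇒t*c≤∣S∣ (proj₁ τ) (ℚ.<⇒≤ t<1) S₂≢∅ N₂)
                ∣S₁∣+∣S₂∣≤t*k₁+t*k₂
        where
        open ℚ.≤-Reasoning
        t*-mono : ∀ {p q} → p ≤ q → t * p ≤ t * q
        t*-mono = ℚ.*-monoˡ-≤-nonNeg t {{nonNegative (toughness-nonNeg τ)}}
        ∣S₁∣+∣S₂∣≤t*k₁+t*k₂ : [ ∣ S ∩ V₁ ∣ ]ℚ + [ ∣ S ∩ V₂ ∣ ]ℚ ≤ t * [ k₁ ]ℚ + t * [ k₂ ]ℚ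
        ∣S₁∣+∣S₂∣≤t*k₁+t*k₂ = begin
          [ ∣ S ∩ V₁ ∣ ]ℚ + [ ∣ S ∩ V₂ ∣ ]ℚ   ≡⟨ [m+n]ℚ ∣ S ∩ V₁ ∣ ∣ S ∩ V₂ ∣ ⟨
          [ ∣ S ∩ V₁ ∣ ℕ.+ ∣ S ∩ V₂ ∣ ]ℚ     ≡⟨ cong [_]ℚ ∣S∣≡∣S∩V₁∣+∣S∩V₂∣ ⟨
          [ ∣ S ∣ ]ℚ                          ≡⟨ ∣S∣≡t*k ⟩
          t * [ k ]ℚ                          ≤⟨ t*-mono ([]ℚ-mono-≤ (components-≤ N N₁ N₂)) ⟩
          t * [ k₁ ℕ.+ k₂ ]ℚ                  ≡⟨ cong (t *_) ([m+n]ℚ k₁ k₂) ⟩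
          t * ([ k₁ ]ℚ + [ k₂ ]ℚ)             ≡⟨ ℚ.*-distribˡ-+ t [ k₁ ]ℚ [ k₂ ]ℚ ⟩
          t * [ k₁ ]ℚ + t * [ k₂ ]ℚ           ∎

      toughSet-pieces : IsToughSet G t S →
        Nonempty (S ∩ V₁) → Nonempty (S ∩ V₂) →
        (∀ k → NumComp G (S ∩ V₁) k → k ≢ 0 × [ ∣ S ∩ V₁ ∣ ]ℚ ≡ t * [ k ]ℚ) ×
        (∀ k → NumComp G (S ∩ V₂) k → k ≢ 0 × [ ∣ S ∩ V₂ ∣ ]ℚ ≡ t * [ k ]ℚ)
      toughSet-pieces tough S₁≢∅ S₂≢∅ =
        (λ _ N₁ → numComp-nonZero (∉-∩ {V = V₁} u∉S) N₁ ,
                  proj₁ (toughSet-pieces-tight tough S₁≢∅ S₂≢∅ N₁ (proj₂ (numComp G (S ∩ V₂))))) ,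
        (λ _ N₂ → numComp-nonZero (∉-∩ {V = V₂} u∉S) N₂ ,
                  proj₂ (toughSet-pieces-tight tough S₁≢∅ S₂≢∅ (proj₂ (numComp G (S ∩ V₁))) N₂))

      -- If both pieces were nonempty, S ∩ V₁ would be a strictly smaller tough set.
      minimal-toughSet-one-side : IsToughSet G t S →
        (∀ T → IsToughSet G t T → ∣ S ∣ ℕ.≤ ∣ T ∣) →
        (∀ x → x ∈ S → x ∈ V₁ × x ≢ u × x ≢ v) ⊎ (∀ x → x ∈ S → x ∈ V₂ × x ≢ u × x ≢ v)
      minimal-toughSet-one-side tough minimal with nonempty? (S ∩ V₁) | nonempty? (S ∩ V₂)
      ... | _         | no S₂≡∅  =
        inj₁ (λ _ x∈S → ∈-other-side S₂≡∅ x∈S (V₁∪V₂ _) , ∈S⇒≢u x∈S , ∈S⇒≢v x∈S)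
      ... | no S₁≡∅   | _        =
        inj₂ (λ _ x∈S → ∈-other-side S₁≡∅ x∈S (swap (V₁∪V₂ _)) , ∈S⇒≢u x∈S , ∈S⇒≢v x∈S)
      ... | yes S₁≢∅  | yes S₂≢∅ = ⊥-elim (ℕ.<⇒≱ ∣S₁∣<∣S∣ (minimal (S ∩ V₁) S₁-tough))
        where
        S₁-tough : IsToughSet G t (S ∩ V₁)
        S₁-tough with numComp G (S ∩ V₁) | numComp G (S ∩ V₂)
        ... | _ , N₁ | _ , N₂ =
          toughSet-of-≡ t<1 S₁≢∅ N₁ (numComp-nonZero (∉-∩ {V = V₁} u∉S) N₁)
            (proj₁ (toughSet-pieces-tight tough S₁≢∅ S₂≢∅ N₁ N₂))
        ∣S₁∣<∣S∣ : ∣ S ∩ V₁ ∣ ℕ.< ∣ S ∣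
        ∣S₁∣<∣S∣ = subst (∣ S ∩ V₁ ∣ ℕ.<_) (≡.sym ∣S∣≡∣S∩V₁∣+∣S∩V₂∣)
          (ℕ.m<m+n ∣ S ∩ V₁ ∣ (nonempty⇒∣p∣≥1 S₂≢∅))

lemma2p5 : ∀ {n : ℕ} (G₁ G₂ : Graph n) (V₁ V₂ : Subset n) (u v : Fin n) →
    EdgesWithin G₁ V₁ → EdgesWithin G₂ V₂ →
    (∀ x y → ¬ (adj G₁ x y ≡ true × adj G₂ x y ≡ true)) →
    u ≢ v →
    (∀ x → (x ∈ V₁ × x ∈ V₂) ⇔ (x ≡ u ⊎ x ≡ v)) →
    (∀ x → x ∈ V₁ ⊎ x ∈ V₂) →
    (t : ℚ) → IsToughness (G₁ ∪G G₂) t → t < 1ℚ →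
    ((S : Subset n) → IsToughSet (G₁ ∪G G₂) t S →
       (∀ T → IsToughSet (G₁ ∪G G₂) t T → ∣ S ∣ ℕ.≤ ∣ T ∣) →
       u ∉ S → v ∉ S →
       (∀ x → x ∈ S → x ∈ V₁ × x ≢ u × x ≢ v) ⊎
       (∀ x → x ∈ S → x ∈ V₂ × x ≢ u × x ≢ v))
    ×
    ((S : Subset n) → IsToughSet (G₁ ∪G G₂) t S →
       u ∉ S → v ∉ S →
       Nonempty (S ∩ V₁) → Nonempty (S ∩ V₂) →
       (∀ k → NumComp (G₁ ∪G G₂) (S ∩ V₁) k →
          k ≢ 0 × [ ∣ S ∩ V₁ ∣ ]ℚ ≡ t * [ k ]ℚ) ×
       (∀ k → NumComp (G₁ ∪G G₂) (S ∩ V₂) k →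
          k ≢ 0 × [ ∣ S ∩ V₂ ∣ ]ℚ ≡ t * [ k ]ℚ))
lemma2p5 G₁ G₂ V₁ V₂ u v E₁ E₂ _ _ V₁∩V₂ V₁∪V₂ t τ t<1 =
  (λ S tough minimal u∉S v∉S → minimal-toughSet-one-side S u∉S v∉S τ t<1 tough minimal) ,
  (λ S tough u∉S v∉S → toughSet-pieces S u∉S v∉S τ t<1 tough)
  where open TwoSeparation G₁ G₂ V₁ V₂ u v E₁ E₂ V₁∩V₂ V₁∪V₂
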